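{- Let $f$ be an extended Boolean function in $n$ arguments that is representable by a quadratic polynomial. Then the set of graphs of all quadratic polynomials representing $f$ is a switching class, i.e., it consists of a graph $H$ on the vertex set $\{x_1,\dots,x_n\}$ together with all switchings of $H$.
   Context: An extended Boolean function in $n$ arguments is a function $f:\{(x_1,\dots,x_n)\in\{0,1\}^n : x_1+\dots+x_n\equiv 0 \pmod 2\}\to\{0,1\}$. A polynomial over $\mathrm{GF}(2)$ in $x_1,\dots,x_n$ (in multilinear form, i.e. a sum of distinct monomials that are products of distinct variables) represents $f$ if it agrees with $f$ at every point of this domain. A polynomial is quadratic if its degree is at most $2$. The graph of a quadratic polynomial is the graph on vertex set $\{x_1,\dots,x_n\}$ in which $x_i,x_j$ ($i\ne j$) are adjacent iff the monomial $x_ix_j$ occurs in the polynomial. For a graph $G=(V,E)$ and $U\subseteq V$ (possibly empty or equal to $V$), the $U$-switching of $G$ is $G_U=(V,E\,\triangle\,E_{U,V\setminus U})$, where $E_{U,V\setminus U}$ is the edge set of the complete bipartite graph on $V$ with parts $U$ and $V\setminus U$; the switching class of $G$ is the set of all its switchings. -}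

module Defs where

open import Data.Bool using (Bool; true; false; _∧_; _xor_; if_then_else_)
open import Data.Bool.Properties using (xor-comm; xor-same)
open import Data.Fin using (Fin; zero; suc; toℕ)
open import Data.Nat using (ℕ; _<ᵇ_)
open import Data.Product using (Σ; ∃; _×_; _,_)
open import Function.Bundles using (_⇔_)
open import Relation.Binary.PropositionalEquality using (_≡_; refl; cong₂; trans)

⊕Σ : (n : ℕ) → (Fin n → Bool) → Bool
⊕Σ ℕ.zero    f = false
⊕Σ (ℕ.suc n) f = f zero xor ⊕Σ n (λ i → f (suc i))

-- Points of {0,1}^n; the domain of an extended Boolean function is the set of
-- points with x_1 + ... + x_n ≡ 0 (mod 2), i.e. parity false.
Point : ℕ → Set
Point n = Fin n → Bool

parity : {n : ℕ} → Point n → Bool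
parity {n} x = ⊕Σ n x

ExtBoolFun : ℕ → Set
ExtBoolFun n = (x : Point n) → parity x ≡ false → Bool

record Graph (n : ℕ) : Set where
  field
    adj    : Fin n → Fin n → Bool
    sym    : ∀ i j → adj i j ≡ adj j i
    irrefl : ∀ i → adj i i ≡ false
open Graph public

_≈G_ : {n : ℕ} → Graph n → Graph n → Set
G ≈G H = ∀ i j → adj G i j ≡ adj H i j

-- U-switching of G, for U ⊆ V given as a characteristic function:
-- an edge of K_{U,V∖U} joins i,j iff exactly one of i,j lies in U.
switch : {n : ℕ} → (Fin n → Bool) → Graph n → Graph n
switch U G = record
  { adj    = λ i j → adj G i j xor (U i xor U j)
  ; sym    = λ i j → cong₂ _xor_ (sym G i j) (xor-comm (U i) (U j))
  ; irrefl = λ i → trans (cong₂ _xor_ (irrefl G i) (xor-same (U i))) refl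
  }

-- A quadratic multilinear polynomial over GF(2) in x_1..x_n:
--   c + Σ_i l_i x_i + Σ_{i<j, ij ∈ E(G)} x_i x_j.
record QuadPoly (n : ℕ) : Set where
  field
    const : Bool
    lin   : Fin n → Bool
    quad  : Graph n
open QuadPoly public

graphOf : {n : ℕ} → QuadPoly n → Graph n
graphOf P = quad P

eval : {n : ℕ} → QuadPoly n → Point n → Bool
eval {n} P x =
  const P
  xor ⊕Σ n (λ i → lin P i ∧ x i)
  xor ⊕Σ n (λ i → ⊕Σ n (λ j →
        if toℕ i <ᵇ toℕ j then adj (quad P) i j ∧ (x i ∧ x j) else false))

Represents : {n : ℕ} → QuadPoly n → ExtBoolFun n → Set
Represents {n} P f = (x : Point n) (e : parity x ≡ false) → eval P x ≡ f x e

-- Over GF(2) the polynomials vanishing on the even-weight points form a vector space, and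
-- two polynomials represent the same function iff their sum lies in it.  A vanishing
-- quadratic polynomial is determined by its linear part u: evaluating at 0 and at e_i + e_j
-- forces the constant to be 0 and x_i x_j to occur iff u_i ≠ u_j, so its graph is the complete
-- bipartite graph between u and its complement.  Conversely every such polynomial vanishes, since
-- Σ_{i<j} (u_i + u_j) x_i x_j = Σ_i u_i x_i (Σ_{j≠i} x_j) = Σ_i u_i x_i (1 + Σ_j x_j) on
-- {0,1}^n.  Adding it to a polynomial performs the u-switching of its graph.
module Submission where

open import Defs hiding (sym)
open import Algebra.Bundles using (CommutativeRing)
open import Data.Bool using (Bool; true; false; _∧_; _xor_; if_then_else_)
open import Data.Bool.Properties
  using (xor-∧-commutativeRing; xor-assoc; xor-comm; xor-same; xor-identityʳ;
         ∧-comm; ∧-assoc; ∧-idem; ∧-identityʳ; ∧-zeroʳ; ∧-distribʳ-xor; if-float; if-eta)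
open import Data.Fin using (Fin; zero; suc; toℕ)
open import Data.Fin.Properties using (_≟_)
open import Data.Nat using (ℕ; _<ᵇ_)
open import Data.Product using (∃; _×_; _,_)
open import Function.Bundles using (_⇔_; mk⇔)
open import Relation.Nullary using (¬_; does; yes; no)
open import Relation.Nullary.Decidable using (dec-false)
open import Relation.Binary.PropositionalEquality
  using (_≡_; refl; sym; trans; cong; cong₂; module ≡-Reasoning)
open import Algebra.Properties.CommutativeSemigroup
  (CommutativeRing.+-commutativeSemigroup xor-∧-commutativeRing) using (interchange)

open ≡-Reasoning

private
  variable
    n : ℕ

xor-moveʳ : ∀ a b {c} → a xor b ≡ c → a ≡ b xor c
xor-moveʳ a b {c} a⊕b≡c = begin
  a                ≡⟨ sym (xor-identityʳ a) ⟩
  a xor false      ≡⟨ cong (a xor_) (sym (xor-same b)) ⟩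
  a xor (b xor b)  ≡⟨ sym (xor-assoc a b b) ⟩
  (a xor b) xor b  ≡⟨ cong (_xor b) a⊕b≡c ⟩
  c xor b          ≡⟨ xor-comm c b ⟩
  b xor c          ∎

⊕Σ-zero : ∀ n → ⊕Σ n (λ _ → false) ≡ false
⊕Σ-zero ℕ.zero    = refl
⊕Σ-zero (ℕ.suc n) = ⊕Σ-zero n

⊕Σ-cong : ∀ n {f g : Fin n → Bool} → (∀ i → f i ≡ g i) → ⊕Σ n f ≡ ⊕Σ n g
⊕Σ-cong ℕ.zero    f≗g = refl
⊕Σ-cong (ℕ.suc n) f≗g = cong₂ _xor_ (f≗g zero) (⊕Σ-cong n (λ i → f≗g (suc i)))

⊕Σ-xor : ∀ n (f g : Fin n → Bool) →
         ⊕Σ n (λ i → f i xor g i) ≡ ⊕Σ n f xor ⊕Σ n g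
⊕Σ-xor ℕ.zero    f g = refl
⊕Σ-xor (ℕ.suc n) f g = trans
  (cong ((f zero xor g zero) xor_) (⊕Σ-xor n (λ i → f (suc i)) (λ i → g (suc i))))
  (interchange (f zero) (g zero) _ _)

⊕Σ-∧-distribˡ : ∀ n b (f : Fin n → Bool) → ⊕Σ n (λ i → b ∧ f i) ≡ b ∧ ⊕Σ n f
⊕Σ-∧-distribˡ n true  f = refl
⊕Σ-∧-distribˡ n false f = ⊕Σ-zero n

⊕Σ-swap : ∀ n m (F : Fin n → Fin m → Bool) →
          ⊕Σ n (λ i → ⊕Σ m (F i)) ≡ ⊕Σ m (λ j → ⊕Σ n (λ i → F i j))
⊕Σ-swap ℕ.zero    m F = sym (⊕Σ-zero m)
⊕Σ-swap (ℕ.suc n) m F = trans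
  (cong (⊕Σ m (F zero) xor_) (⊕Σ-swap n m (λ i → F (suc i))))
  (sym (⊕Σ-xor m (F zero) (λ j → ⊕Σ n (λ i → F (suc i) j))))

⊕Σ² : (n : ℕ) → (Fin n → Fin n → Bool) → Bool
⊕Σ² n M = ⊕Σ n (λ k → ⊕Σ n (M k))

⊕Σ²-cong : ∀ n {M N : Fin n → Fin n → Bool} →
           (∀ k l → M k l ≡ N k l) → ⊕Σ² n M ≡ ⊕Σ² n N
⊕Σ²-cong n M≗N = ⊕Σ-cong n (λ k → ⊕Σ-cong n (M≗N k))

⊕Σ²-xor : ∀ n (M N : Fin n → Fin n → Bool) →
          ⊕Σ² n (λ k l → M k l xor N k l) ≡ ⊕Σ² n M xor ⊕Σ² n N
⊕Σ²-xor n M N = trans (⊕Σ-cong n (λ k → ⊕Σ-xor n (M k) (N k))) (⊕Σ-xor n _ _)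

δ : Fin n → Point n
δ i k = does (i ≟ k)

⊕Σ-δ : ∀ n (i : Fin n) (g : Fin n → Bool) → ⊕Σ n (λ k → δ i k ∧ g k) ≡ g i
⊕Σ-δ (ℕ.suc n) zero    g = trans (cong (g zero xor_) (⊕Σ-zero n)) (xor-identityʳ (g zero))
⊕Σ-δ (ℕ.suc n) (suc i) g = ⊕Σ-δ n i (λ k → g (suc k))

origin : Point n
origin _ = false

pair : Fin n → Fin n → Point n
pair i j k = δ i k xor δ j k

⊕Σ-pair : ∀ n (i j : Fin n) (g : Fin n → Bool) →
          ⊕Σ n (λ k → pair i j k ∧ g k) ≡ g i xor g j
⊕Σ-pair n i j g = begin
  ⊕Σ n (λ k → pair i j k ∧ g k)                    ≡⟨ ⊕Σ-cong n (λ k → ∧-distribʳ-xor (g k) (δ i k) (δ j k)) ⟩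
  ⊕Σ n (λ k → (δ i k ∧ g k) xor (δ j k ∧ g k))     ≡⟨ ⊕Σ-xor n _ _ ⟩
  ⊕Σ n (λ k → δ i k ∧ g k) xor ⊕Σ n (λ k → δ j k ∧ g k) ≡⟨ cong₂ _xor_ (⊕Σ-δ n i g) (⊕Σ-δ n j g) ⟩
  g i xor g j                                       ∎

parity-origin : parity (origin {n}) ≡ false
parity-origin {n} = ⊕Σ-zero n

parity-pair : (i j : Fin n) → parity (pair i j) ≡ false
parity-pair {n} i j = trans
  (⊕Σ-cong n (λ k → sym (∧-identityʳ (pair i j k))))
  (⊕Σ-pair n i j (λ _ → true))

strictUpper strictLower : (Fin n → Fin n → Bool) → Fin n → Fin n → Bool
strictUpper M k l = if toℕ k <ᵇ toℕ l then M k l else false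
strictLower M k l = if toℕ l <ᵇ toℕ k then M k l else false

strictUpper-xor : (M N : Fin n → Fin n → Bool) (k l : Fin n) →
  strictUpper (λ k l → M k l xor N k l) k l ≡ strictUpper M k l xor strictUpper N k l
strictUpper-xor M N k l with toℕ k <ᵇ toℕ l
... | true  = refl
... | false = refl

strictUpper-xor-strictLower : (M : Fin n → Fin n → Bool) (k l : Fin n) →
  strictUpper M k l xor strictLower M k l ≡ M k l xor (δ k l ∧ M k l)
strictUpper-xor-strictLower M zero    zero    = sym (xor-same (M zero zero))
strictUpper-xor-strictLower M zero    (suc l) = refl
strictUpper-xor-strictLower M (suc k) zero    = sym (xor-identityʳ (M (suc k) zero))
strictUpper-xor-strictLower M (suc k) (suc l) =
  strictUpper-xor-strictLower (λ k l → M (suc k) (suc l)) k l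

strictUpper-diagonal : (G : Graph n) (i : Fin n) → strictUpper (adj G) i i ≡ false
strictUpper-diagonal G i =
  trans (cong (λ a → if toℕ i <ᵇ toℕ i then a else false) (irrefl G i)) (if-eta (toℕ i <ᵇ toℕ i))

linForm : (Fin n → Bool) → Point n → Bool
linForm {n} u x = ⊕Σ n (λ k → u k ∧ x k)

quadForm : (Fin n → Fin n → Bool) → Point n → Bool
quadForm {n} M x = ⊕Σ² n (λ k l → M k l ∧ (x k ∧ x l))

linForm-xor : (u v : Fin n → Bool) (x : Point n) →
  linForm (λ k → u k xor v k) x ≡ linForm u x xor linForm v x
linForm-xor {n} u v x =
  trans (⊕Σ-cong n (λ k → ∧-distribʳ-xor (x k) (u k) (v k))) (⊕Σ-xor n _ _)

quadForm-xor : (M N : Fin n → Fin n → Bool) (x : Point n) →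
  quadForm (λ k l → M k l xor N k l) x ≡ quadForm M x xor quadForm N x
quadForm-xor {n} M N x =
  trans (⊕Σ²-cong n (λ k l → ∧-distribʳ-xor (x k ∧ x l) (M k l) (N k l))) (⊕Σ²-xor n _ _)

linForm-origin : (u : Fin n → Bool) → linForm u origin ≡ false
linForm-origin {n} u = trans (⊕Σ-cong n (λ k → ∧-zeroʳ (u k))) (⊕Σ-zero n)

quadForm-origin : (M : Fin n → Fin n → Bool) → quadForm M origin ≡ false
quadForm-origin {n} M = begin
  quadForm M origin            ≡⟨ ⊕Σ²-cong n (λ k l → ∧-zeroʳ (M k l)) ⟩
  ⊕Σ² n (λ _ _ → false)        ≡⟨ ⊕Σ-cong n (λ _ → ⊕Σ-zero n) ⟩
  ⊕Σ n (λ _ → false)           ≡⟨ ⊕Σ-zero n ⟩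
  false                        ∎

linForm-pair : (u : Fin n → Bool) (i j : Fin n) → linForm u (pair i j) ≡ u i xor u j
linForm-pair {n} u i j =
  trans (⊕Σ-cong n (λ k → ∧-comm (u k) (pair i j k))) (⊕Σ-pair n i j u)

quadForm-pair : (M : Fin n → Fin n → Bool) (i j : Fin n) →
  quadForm M (pair i j) ≡ (M i i xor M i j) xor (M j i xor M j j)
quadForm-pair {n} M i j = begin
  ⊕Σ² n (λ k l → M k l ∧ (x k ∧ x l))       ≡⟨ ⊕Σ²-cong n (λ k l → rearrange (M k l) (x k) (x l)) ⟩
  ⊕Σ n (λ k → ⊕Σ n (λ l → x k ∧ (x l ∧ M k l))) ≡⟨ ⊕Σ-cong n (λ k → ⊕Σ-∧-distribˡ n (x k) _) ⟩
  ⊕Σ n (λ k → x k ∧ ⊕Σ n (λ l → x l ∧ M k l)) ≡⟨ ⊕Σ-cong n (λ k → cong (x k ∧_) (⊕Σ-pair n i j (M k))) ⟩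
  ⊕Σ n (λ k → x k ∧ (M k i xor M k j))     ≡⟨ ⊕Σ-pair n i j (λ k → M k i xor M k j) ⟩
  (M i i xor M i j) xor (M j i xor M j j)   ∎
  where
  x = pair i j
  rearrange : ∀ a p q → a ∧ (p ∧ q) ≡ p ∧ (q ∧ a)
  rearrange a p q = trans (∧-comm a (p ∧ q)) (∧-assoc p q a)

quadForm-strictUpper-pair : (G : Graph n) {i j : Fin n} → ¬ i ≡ j →
  quadForm (strictUpper (adj G)) (pair i j) ≡ adj G i j
quadForm-strictUpper-pair G {i} {j} i≢j = begin
  quadForm U (pair i j)                       ≡⟨ quadForm-pair U i j ⟩
  (U i i xor U i j) xor (U j i xor U j j)     ≡⟨ cong₂ (λ a b → (a xor U i j) xor (U j i xor b))
                                                       (strictUpper-diagonal G i) (strictUpper-diagonal G j) ⟩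
  U i j xor (U j i xor false)                 ≡⟨ cong (U i j xor_) (xor-identityʳ (U j i)) ⟩
  U i j xor U j i                             ≡⟨ cong (λ a → U i j xor (if toℕ j <ᵇ toℕ i then a else false))
                                                      (Graph.sym G j i) ⟩
  U i j xor strictLower (adj G) i j           ≡⟨ strictUpper-xor-strictLower (adj G) i j ⟩
  adj G i j xor (δ i j ∧ adj G i j)           ≡⟨ cong (λ d → adj G i j xor (d ∧ adj G i j)) (dec-false (i ≟ j) i≢j) ⟩
  adj G i j xor false                         ≡⟨ xor-identityʳ (adj G i j) ⟩
  adj G i j                                   ∎
  where
  U = strictUpper (adj G)

-- Off-diagonal pairs are counted once on each side of the diagonal, diagonal entries twice.
⊕Σ²-strictUpper-symmetrise : ∀ n (N : Fin n → Fin n → Bool) →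
  ⊕Σ² n (strictUpper (λ k l → N k l xor N l k)) ≡ ⊕Σ² n N xor ⊕Σ n (λ k → N k k)
⊕Σ²-strictUpper-symmetrise n N = begin
  ⊕Σ² n (strictUpper (λ k l → N k l xor N l k))
    ≡⟨ ⊕Σ²-cong n (strictUpper-xor N (λ k l → N l k)) ⟩
  ⊕Σ² n (λ k l → strictUpper N k l xor strictUpper (λ k l → N l k) k l)
    ≡⟨ ⊕Σ²-xor n _ _ ⟩
  ⊕Σ² n (strictUpper N) xor ⊕Σ² n (strictUpper (λ k l → N l k))
    ≡⟨ cong (⊕Σ² n (strictUpper N) xor_) (⊕Σ-swap n n (strictUpper (λ k l → N l k))) ⟩
  ⊕Σ² n (strictUpper N) xor ⊕Σ² n (strictLower N)
    ≡⟨ sym (⊕Σ²-xor n _ _) ⟩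
  ⊕Σ² n (λ k l → strictUpper N k l xor strictLower N k l)
    ≡⟨ ⊕Σ²-cong n (strictUpper-xor-strictLower N) ⟩
  ⊕Σ² n (λ k l → N k l xor (δ k l ∧ N k l))
    ≡⟨ ⊕Σ²-xor n _ _ ⟩
  ⊕Σ² n N xor ⊕Σ² n (λ k l → δ k l ∧ N k l)
    ≡⟨ cong (⊕Σ² n N xor_) (⊕Σ-cong n (λ k → ⊕Σ-δ n k (N k))) ⟩
  ⊕Σ² n N xor ⊕Σ n (λ k → N k k)
    ∎

quadForm-strictUpper-symmetrise : (M : Fin n → Fin n → Bool) (x : Point n) →
  quadForm (strictUpper (λ k l → M k l xor M l k)) x ≡ quadForm M x xor linForm (λ k → M k k) x
quadForm-strictUpper-symmetrise {n} M x = begin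
  quadForm (strictUpper (λ k l → M k l xor M l k)) x
    ≡⟨ ⊕Σ²-cong n weight-strictUpper ⟩
  ⊕Σ² n (strictUpper (λ k l → N k l xor N l k))
    ≡⟨ ⊕Σ²-strictUpper-symmetrise n N ⟩
  quadForm M x xor ⊕Σ n (λ k → N k k)
    ≡⟨ cong (quadForm M x xor_) (⊕Σ-cong n (λ k → cong (M k k ∧_) (∧-idem (x k)))) ⟩
  quadForm M x xor linForm (λ k → M k k) x
    ∎
  where
  N : Fin n → Fin n → Bool
  N k l = M k l ∧ (x k ∧ x l)
  weight-strictUpper : ∀ k l →
    strictUpper (λ k l → M k l xor M l k) k l ∧ (x k ∧ x l) ≡ strictUpper (λ k l → N k l xor N l k) k l
  weight-strictUpper k l = trans
    (if-float (_∧ (x k ∧ x l)) (toℕ k <ᵇ toℕ l))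
    (cong (λ t → if toℕ k <ᵇ toℕ l then t else false)
          (trans (∧-distribʳ-xor (x k ∧ x l) (M k l) (M l k))
                 (cong (λ p → N k l xor (M l k ∧ p)) (∧-comm (x k) (x l)))))

eval-decompose : (P : QuadPoly n) (x : Point n) →
  eval P x ≡ const P xor (linForm (lin P) x xor quadForm (strictUpper (adj (quad P))) x)
eval-decompose {n} P x =
  cong (λ q → const P xor (linForm (lin P) x xor q))
       (⊕Σ²-cong n (λ k l → sym (if-float (_∧ (x k ∧ x l)) (toℕ k <ᵇ toℕ l))))

eval-origin : (P : QuadPoly n) → eval P origin ≡ const P
eval-origin P = begin
  eval P origin                    ≡⟨ eval-decompose P origin ⟩
  const P xor (linForm (lin P) origin xor quadForm (strictUpper (adj (quad P))) origin)
                                   ≡⟨ cong₂ (λ a b → const P xor (a xor b))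
                                            (linForm-origin (lin P)) (quadForm-origin (strictUpper (adj (quad P)))) ⟩
  const P xor false                ≡⟨ xor-identityʳ (const P) ⟩
  const P                          ∎

eval-pair : (P : QuadPoly n) {i j : Fin n} → ¬ i ≡ j →
  eval P (pair i j) ≡ const P xor ((lin P i xor lin P j) xor adj (quad P) i j)
eval-pair P {i} {j} i≢j = trans (eval-decompose P (pair i j))
  (cong₂ (λ a b → const P xor (a xor b))
         (linForm-pair (lin P) i j) (quadForm-strictUpper-pair (quad P) i≢j))

emptyGraph : Graph n
emptyGraph = record { adj = λ _ _ → false ; sym = λ _ _ → refl ; irrefl = λ _ → refl }

completeBipartite : (Fin n → Bool) → Graph n
completeBipartite U = switch U emptyGraph

_⊕ᴳ_ : Graph n → Graph n → Graph n
G ⊕ᴳ H = record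
  { adj    = λ i j → adj G i j xor adj H i j
  ; sym    = λ i j → cong₂ _xor_ (Graph.sym G i j) (Graph.sym H i j)
  ; irrefl = λ i → cong₂ _xor_ (irrefl G i) (irrefl H i)
  }

_⊕ᴾ_ : QuadPoly n → QuadPoly n → QuadPoly n
P ⊕ᴾ Q = record
  { const = const P xor const Q
  ; lin   = λ k → lin P k xor lin Q k
  ; quad  = quad P ⊕ᴳ quad Q
  }

eval-⊕ᴾ : (P Q : QuadPoly n) (x : Point n) → eval (P ⊕ᴾ Q) x ≡ eval P x xor eval Q x
eval-⊕ᴾ {n} P Q x = begin
  eval (P ⊕ᴾ Q) x
    ≡⟨ eval-decompose (P ⊕ᴾ Q) x ⟩
  (cP xor cQ) xor (linForm (λ k → lin P k xor lin Q k) x xor quadForm (strictUpper (adj (quad P ⊕ᴳ quad Q))) x)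
    ≡⟨ cong₂ (λ a b → (cP xor cQ) xor (a xor b)) (linForm-xor (lin P) (lin Q) x) quadForm-⊕ ⟩
  (cP xor cQ) xor ((LP xor LQ) xor (QP xor QQ))
    ≡⟨ cong ((cP xor cQ) xor_) (interchange LP LQ QP QQ) ⟩
  (cP xor cQ) xor ((LP xor QP) xor (LQ xor QQ))
    ≡⟨ interchange cP cQ (LP xor QP) (LQ xor QQ) ⟩
  (cP xor (LP xor QP)) xor (cQ xor (LQ xor QQ))
    ≡⟨ sym (cong₂ _xor_ (eval-decompose P x) (eval-decompose Q x)) ⟩
  eval P x xor eval Q x
    ∎
  where
  cP = const P
  cQ = const Q
  LP = linForm (lin P) x
  LQ = linForm (lin Q) x
  QP = quadForm (strictUpper (adj (quad P))) x
  QQ = quadForm (strictUpper (adj (quad Q))) x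
  quadForm-⊕ : quadForm (strictUpper (adj (quad P ⊕ᴳ quad Q))) x ≡ QP xor QQ
  quadForm-⊕ = trans
    (⊕Σ²-cong n (λ k l → cong (_∧ (x k ∧ x l)) (strictUpper-xor (adj (quad P)) (adj (quad Q)) k l)))
    (quadForm-xor (strictUpper (adj (quad P))) (strictUpper (adj (quad Q))) x)

Vanishes : QuadPoly n → Set
Vanishes {n} Z = (x : Point n) → parity x ≡ false → eval Z x ≡ false

represents-⊕ᴾ-vanishing : (P Z : QuadPoly n) {f : ExtBoolFun n} →
  Represents P f → Vanishes Z → Represents (P ⊕ᴾ Z) f
represents-⊕ᴾ-vanishing P Z {f} P-rep Z-vanishes x even = begin
  eval (P ⊕ᴾ Z) x       ≡⟨ eval-⊕ᴾ P Z x ⟩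
  eval P x xor eval Z x ≡⟨ cong₂ _xor_ (P-rep x even) (Z-vanishes x even) ⟩
  f x even xor false    ≡⟨ xor-identityʳ (f x even) ⟩
  f x even              ∎

represents-both⇒⊕ᴾ-vanishes : (P Q : QuadPoly n) {f : ExtBoolFun n} →
  Represents P f → Represents Q f → Vanishes (P ⊕ᴾ Q)
represents-both⇒⊕ᴾ-vanishes P Q {f} P-rep Q-rep x even = begin
  eval (P ⊕ᴾ Q) x       ≡⟨ eval-⊕ᴾ P Q x ⟩
  eval P x xor eval Q x ≡⟨ cong₂ _xor_ (P-rep x even) (Q-rep x even) ⟩
  f x even xor f x even ≡⟨ xor-same (f x even) ⟩
  false                 ∎

switchingPoly : (Fin n → Bool) → QuadPoly n
switchingPoly U = record { const = false ; lin = U ; quad = completeBipartite U }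

switchingPoly-vanishes : (U : Fin n → Bool) → Vanishes (switchingPoly U)
switchingPoly-vanishes {n} U x even = begin
  eval (switchingPoly U) x
    ≡⟨ eval-decompose (switchingPoly U) x ⟩
  linForm U x xor quadForm (strictUpper (λ k l → U k xor U l)) x
    ≡⟨ cong (linForm U x xor_) (quadForm-strictUpper-symmetrise (λ k _ → U k) x) ⟩
  linForm U x xor (quadForm (λ k _ → U k) x xor linForm U x)
    ≡⟨ cong (λ q → linForm U x xor (q xor linForm U x)) rowConstant-even ⟩
  linForm U x xor linForm U x
    ≡⟨ xor-same (linForm U x) ⟩
  false
    ∎
  where
  rowConstant-even : quadForm (λ k _ → U k) x ≡ false
  rowConstant-even = trans
    (⊕Σ-cong n (λ k → trans
      (⊕Σ-cong n (λ l → sym (∧-assoc (U k) (x k) (x l))))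
      (trans (⊕Σ-∧-distribˡ n (U k ∧ x k) x)
             (trans (cong ((U k ∧ x k) ∧_) even) (∧-zeroʳ (U k ∧ x k))))))
    (⊕Σ-zero n)

vanishes⇒graph≈completeBipartite : (Z : QuadPoly n) → Vanishes Z →
  quad Z ≈G completeBipartite (lin Z)
vanishes⇒graph≈completeBipartite {n} Z Z-vanishes i j with i ≟ j
... | yes refl = trans (irrefl (quad Z) i) (sym (irrefl (completeBipartite (lin Z)) i))
... | no  i≢j  = sym (trans (xor-moveʳ (lin Z i xor lin Z j) _ linear+quadratic≡0)
                            (xor-identityʳ (adj (quad Z) i j)))
  where
  const≡0 : const Z ≡ false
  const≡0 = trans (sym (eval-origin Z)) (Z-vanishes origin (parity-origin {n}))
  linear+quadratic≡0 : (lin Z i xor lin Z j) xor adj (quad Z) i j ≡ false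
  linear+quadratic≡0 = begin
    (lin Z i xor lin Z j) xor adj (quad Z) i j                ≡⟨ cong (_xor _) (sym const≡0) ⟩
    const Z xor ((lin Z i xor lin Z j) xor adj (quad Z) i j)  ≡⟨ sym (eval-pair Z i≢j) ⟩
    eval Z (pair i j)                                          ≡⟨ Z-vanishes (pair i j) (parity-pair i j) ⟩
    false                                                      ∎

lemma3 : (n : ℕ) (f : ExtBoolFun n) →
    (∃ λ (P : QuadPoly n) → Represents P f) →
    ∃ λ (H : Graph n) → (G : Graph n) →
      (∃ λ (P : QuadPoly n) → Represents P f × graphOf P ≈G G)
        ⇔ (∃ λ (U : Fin n → Bool) → G ≈G switch U H)
lemma3 n f (P₀ , P₀-rep) = quad P₀ , λ G → mk⇔ (to G) (from G)
  where
  to : (G : Graph n) → (∃ λ (P : QuadPoly n) → Represents P f × graphOf P ≈G G) →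
       ∃ λ (U : Fin n → Bool) → G ≈G switch U (quad P₀)
  to G (P , P-rep , P≈G) = lin (P ⊕ᴾ P₀) , λ i j →
    trans (sym (P≈G i j))
          (xor-moveʳ (adj (quad P) i j) (adj (quad P₀) i j)
             (vanishes⇒graph≈completeBipartite (P ⊕ᴾ P₀)
               (represents-both⇒⊕ᴾ-vanishes P P₀ P-rep P₀-rep) i j))
  from : (G : Graph n) → (∃ λ (U : Fin n → Bool) → G ≈G switch U (quad P₀)) →
         ∃ λ (P : QuadPoly n) → Represents P f × graphOf P ≈G G
  from G (U , G≈switch) =
    P₀ ⊕ᴾ switchingPoly U ,
    represents-⊕ᴾ-vanishing P₀ (switchingPoly U) P₀-rep (switchingPoly-vanishes U) ,
    λ i j → sym (G≈switch i j)
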